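{- Let $3\le k_1<k_2$ be integers and $n$ a positive integer. If $\nu_{k_1}(n)>0$, then $\nu_{k_2}(n+k_2-k_1)>0$.
   Context: For an integer $k\ge 3$ and a positive integer $n$, $\nu_k(n)$ denotes the number of $k$-tuples of integers $(x_1,\dots,x_k)$ with $1\le x_1\le x_2\le\dots\le x_k$ such that $n = x_1x_2\cdots x_k + x_1+x_2+\dots+x_k$. -}

module Defs where

open import Data.Nat using (ℕ; zero; suc; _+_; _*_; _≤_)
open import Data.Nat.Properties using (_≤?_; _≟_)
open import Data.List using (List; []; _∷_; length; filter; concatMap; map; upTo)
open import Data.Nat.ListAction using (product; sum)
open import Relation.Binary.PropositionalEquality using (_≡_)

ndTuples : ℕ → ℕ → ℕ → List (List ℕ)
ndTuples zero    lo hi = [] ∷ []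
ndTuples (suc k) lo hi =
  concatMap (λ x → map (x ∷_) (ndTuples k x hi))
            (filter (lo ≤?_) (map suc (upTo hi)))

-- ν k n : the number of k-tuples 1 ≤ x_1 ≤ ... ≤ x_k of integers with
-- n = x_1 ⋯ x_k + x_1 + ⋯ + x_k.  Every such x_i satisfies x_i ≤ n,
-- so enumerating tuples with entries in [1, n] counts them all.
ν : ℕ → ℕ → ℕ
ν k n = length (filter (λ xs → n ≟ (product xs + sum xs)) (ndTuples k 1 n))

{-# OPTIONS --safe #-}
module Submission where

-- Prepending a 1 to a solution of length k for n leaves the product unchanged
-- and raises the sum by one, so it yields a solution of length k + 1 for n + 1;
-- the tuple stays nondecreasing because every entry is at least 1.  Doing this
-- k₂ − k₁ times gives the claim.

open import Defs
open import Data.Nat using (ℕ; zero; suc; _+_; _*_; _∸_; _≤_; _<_; s≤s; z≤n)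
open import Data.Nat.Properties using (≤-refl; ≤-trans; n≤1+n; *-identityˡ; +-suc; +-comm; m∸n+n≡m; +-∸-assoc; <⇒≤; _≟_; _≤?_)
open import Data.Nat.ListAction using (product; sum)
open import Data.List using (List; []; _∷_; _++_; length; filter; concatMap; map; upTo; replicate)
open import Data.List.Properties using (filter-some)
open import Data.List.Membership.Propositional using (_∈_; find; lose)
open import Data.List.Membership.Propositional.Properties
  using (∈-filter⁺; ∈-filter⁻; ∈-map⁺; ∈-map⁻; ∈-upTo⁺; ∈-upTo⁻; ∈-concatMap⁺; ∈-concatMap⁻)
open import Data.List.Relation.Unary.Any using (Any; here; there)
open import Data.Product using (∃; ∃₂; _×_; _,_)
open import Relation.Nullary using (yes; no)
open import Relation.Unary using (Pred; Decidable)
open import Relation.Binary.PropositionalEquality using (_≡_; refl; sym; trans; cong; subst₂; module ≡-Reasoning)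

filter-some⁻ : ∀ {a p} {A : Set a} {P : Pred A p} (P? : Decidable P) xs →
  0 < length (filter P? xs) → Any P xs
filter-some⁻ P? (x ∷ xs) pos with P? x
... | yes px = here px
... | no  _  = there (filter-some⁻ P? xs pos)

∈-range⁺ : ∀ {x hi} → 1 ≤ x → x ≤ hi → x ∈ map suc (upTo hi)
∈-range⁺ {suc x} _ x≤hi = ∈-map⁺ suc (∈-upTo⁺ x≤hi)

∈-range⁻ : ∀ {x hi} → x ∈ map suc (upTo hi) → 1 ≤ x × x ≤ hi
∈-range⁻ x∈ with ∈-map⁻ suc x∈
... | i , i∈ , refl = s≤s z≤n , ∈-upTo⁻ i∈

∈-ndTuples⁺ : ∀ k {lo hi x ys} → 1 ≤ x → lo ≤ x → x ≤ hi → ys ∈ ndTuples k x hi →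
  x ∷ ys ∈ ndTuples (suc k) lo hi
∈-ndTuples⁺ k {lo} {hi} 1≤x lo≤x x≤hi ys∈ =
  ∈-concatMap⁺ (λ x → map (x ∷_) (ndTuples k x hi))
    (lose (∈-filter⁺ (lo ≤?_) (∈-range⁺ 1≤x x≤hi) lo≤x) (∈-map⁺ (_ ∷_) ys∈))

∈-ndTuples⁻ : ∀ k {lo hi xs} → xs ∈ ndTuples (suc k) lo hi →
  ∃₂ λ x ys → xs ≡ x ∷ ys × 1 ≤ x × lo ≤ x × x ≤ hi × ys ∈ ndTuples k x hi
∈-ndTuples⁻ k {lo} {hi} xs∈
  with find (∈-concatMap⁻ (λ x → map (x ∷_) (ndTuples k x hi))
                          {xs = filter (lo ≤?_) (map suc (upTo hi))} xs∈)
... | x , x∈ , xs∈′ with ∈-filter⁻ (lo ≤?_) {xs = map suc (upTo hi)} x∈ | ∈-map⁻ (x ∷_) xs∈′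
... | x∈range , lo≤x | ys , ys∈ , xs≡ with ∈-range⁻ x∈range
... | 1≤x , x≤hi = x , ys , xs≡ , 1≤x , lo≤x , x≤hi , ys∈

∈-ndTuples-mono : ∀ k {lo hi hi′ xs} → hi ≤ hi′ → xs ∈ ndTuples k lo hi → xs ∈ ndTuples k lo hi′
∈-ndTuples-mono zero    _      xs∈ = xs∈
∈-ndTuples-mono (suc k) {lo} {hi} {hi′} hi≤hi′ xs∈ with ∈-ndTuples⁻ k {lo} {hi} xs∈
... | x , ys , refl , 1≤x , lo≤x , x≤hi , ys∈ =
  ∈-ndTuples⁺ k {lo} {hi′} 1≤x lo≤x (≤-trans x≤hi hi≤hi′) (∈-ndTuples-mono k hi≤hi′ ys∈)

Solution : ℕ → ℕ → List ℕ → Set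
Solution k n xs = xs ∈ ndTuples k 1 n × n ≡ product xs + sum xs

ν-pos⇒solution : ∀ k n → 0 < ν k n → ∃ (Solution k n)
ν-pos⇒solution k n pos with find (filter-some⁻ (λ xs → n ≟ product xs + sum xs) (ndTuples k 1 n) pos)
... | xs , xs∈ , n≡ = xs , xs∈ , n≡

solution⇒ν-pos : ∀ k n {xs} → Solution k n xs → 0 < ν k n
solution⇒ν-pos k n (xs∈ , n≡) = filter-some (λ xs → n ≟ product xs + sum xs) (lose xs∈ n≡)

solution-cons-1 : ∀ k n {xs} → Solution k n xs → Solution (suc k) (suc n) (1 ∷ xs)
solution-cons-1 k n {xs} (xs∈ , n≡) =
  ∈-ndTuples⁺ k ≤-refl ≤-refl (s≤s z≤n) (∈-ndTuples-mono k (n≤1+n n) xs∈) ,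
  (begin
    suc n                          ≡⟨ cong suc n≡ ⟩
    suc (product xs + sum xs)      ≡⟨ +-suc (product xs) (sum xs) ⟨
    product xs + suc (sum xs)      ≡⟨ cong (_+ suc (sum xs)) (*-identityˡ (product xs)) ⟨
    1 * product xs + suc (sum xs)  ∎)
  where open ≡-Reasoning

solution-pad-1 : ∀ d k n {xs} → Solution k n xs → Solution (d + k) (d + n) (replicate d 1 ++ xs)
solution-pad-1 zero    k n sol = sol
solution-pad-1 (suc d) k n sol = solution-cons-1 (d + k) (d + n) (solution-pad-1 d k n sol)

ν-pos-shift : ∀ d k n → 0 < ν k n → 0 < ν (d + k) (d + n)
ν-pos-shift d k n pos with ν-pos⇒solution k n pos
... | _ , sol = solution⇒ν-pos (d + k) (d + n) (solution-pad-1 d k n sol)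

proposition3 : (k₁ k₂ n : ℕ) → 3 ≤ k₁ → k₁ < k₂ → 0 < n →
    0 < ν k₁ n → 0 < ν k₂ (n + k₂ ∸ k₁)
proposition3 k₁ k₂ n _ k₁<k₂ _ pos =
  subst₂ (λ k m → 0 < ν k m) d+k₁≡k₂ d+n≡n+k₂∸k₁ (ν-pos-shift d k₁ n pos)
  where
  d : ℕ
  d = k₂ ∸ k₁
  d+k₁≡k₂ : d + k₁ ≡ k₂
  d+k₁≡k₂ = m∸n+n≡m (<⇒≤ k₁<k₂)
  d+n≡n+k₂∸k₁ : d + n ≡ n + k₂ ∸ k₁
  d+n≡n+k₂∸k₁ = trans (+-comm d n) (sym (+-∸-assoc n (<⇒≤ k₁<k₂)))
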